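{- Let $S$ be a unanimity program of length $n$ with state set $Q$, and let $t \in \mathbb{N}_+$. Then $S$ is a sliding-window branching program (SWBP) of window size $t$ if and only if there are functions $\alpha_i\colon \{0,1\}^{k_i} \to Q$ for $i = 0,\dots,n$, where $k_i = i$ if $i < t$ and $k_i = t$ if $i \ge t$, such that: (1) for every $i < t$, every $w \in \{0,1\}^{i}$ and every $y \in \{0,1\}$: $S_i(\alpha_i(w), y) = \alpha_{i+1}(wy)$; (2) for every $t \le i < n$, every $x, y \in \{0,1\}$ and every $w \in \{0,1\}^{t-1}$: $S_i(\alpha_i(xw), y) = \alpha_{i+1}(wy)$. (Here $\alpha_0$ is defined on $\{0,1\}^0 = \{\lambda\}$, where $\lambda$ is the empty word.)
   Context: An (ordered, read-once) branching program of length $n$ and width $w$ consists of a state set $Q$ with $|Q| = w$, an initial state $q_0 \in Q$, and transition functions $P_1,\dots,P_n\colon Q\times\{0,1\}\to Q$; on input $x = x_1\cdots x_n \in \{0,1\}^n$ it starts in $q_0$ and in step $j$ moves from its current state $q$ to $P_j(q,x_j)$. For $0 \le i \le n$, $Q_i \subseteq Q$ denotes the set of states reachable after reading exactly $i$ bits (the $i$-th layer). For a state $q$ in layer $i$ and a string $y$ with $|y| \le n-i$, $S_i(q,y)$ denotes the state reached by starting in $q$ at layer $i$ and reading $y$ (i.e. applying $P_{i+1},\dots,P_{i+|y|}$ successively). A unanimity program is such a program together with subsets $Q^i_{\mathrm{acc}} \subseteq Q_i$ for $i=1,\dots,n$; it accepts $x$ iff for every nonempty prefix $y$ of $x$ the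 state reached after reading $y$ from $q_0$ lies in $Q^{|y|}_{\mathrm{acc}}$. A sliding-window branching program (SWBP) of window size $t$ is a unanimity program such that for every $i \le n-t$, every $y \in \{0,1\}^t$ and every $q, q' \in Q_i$, $S_i(q,y) = S_i(q',y)$. -}

module Defs where

open import Data.Nat using (ℕ; zero; suc; _+_; _∸_; _≤_; _<_; _<?_)
open import Data.Fin using (Fin; fromℕ<)
open import Data.Bool using (Bool)
open import Data.List using (List; []; _∷_; _++_; [_]; length)
open import Data.Product using (Σ; ∃; _×_; _,_)
open import Relation.Nullary using (yes; no)
open import Relation.Binary.PropositionalEquality using (_≡_)

-- An ordered read-once branching program of length n and width w.
-- State set Q = Fin w (so |Q| = w).  The transition P_{j+1} is  P j  for j : Fin n.
record BranchingProgram (n w : ℕ) : Set where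
  field
    q₀ : Fin w
    P  : Fin n → Fin w → Bool → Fin w

  -- one transition at layer i (i.e. P_{i+1}); only ever used for i < n,
  -- for i ≥ n it is an (irrelevant) identity step
  step : ℕ → Fin w → Bool → Fin w
  step i q b with i <? n
  ... | yes i<n = P (fromℕ< i<n) q b
  ... | no  _   = q

  S : ℕ → Fin w → List Bool → Fin w
  S i q []      = q
  S i q (b ∷ y) = S (suc i) (step i q b) y

  Layer : ℕ → Fin w → Set
  Layer i q = Σ (List Bool) λ x → length x ≡ i × S 0 q₀ x ≡ q

-- A unanimity program: a branching program together with accepting sets
-- Q^i_acc ⊆ Q_i for i = 1..n (acc j is Q^{j+1}_acc for j : Fin n).
record UnanimityProgram (n w : ℕ) : Set₁ where
  field
    bp     : BranchingProgram n w
  open BranchingProgram bp public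
  field
    acc    : Fin n → Fin w → Set
    acc-⊆  : ∀ (j : Fin n) q → acc j q → Layer (suc (Data.Fin.toℕ j)) q

IsSWBP : ∀ {n w} → UnanimityProgram n w → ℕ → Set
IsSWBP {n} {w} U t =
  ∀ (i : ℕ) → i + t ≤ n → (y : List Bool) → length y ≡ t →
  ∀ (q q′ : Fin w) → Layer i q → Layer i q′ → S i q y ≡ S i q′ y
  where open UnanimityProgram U

k : ℕ → ℕ → ℕ
k t i with i <? t
... | yes _ = i
... | no  _ = t

-- Existence of α_i : {0,1}^{k_i} → Q_i (i = 0..n) satisfying (1) and (2).
-- α i is given on all of List Bool, but only its values on words of length k_i
-- are ever used (its restriction to {0,1}^{k_i} is the function α_i).
HasWindowFunctions : ∀ {n w} → UnanimityProgram n w → ℕ → Set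
HasWindowFunctions {n} {w} U t =
  Σ (ℕ → List Bool → Fin w) λ α →
    -- α_i maps into the i-th layer (S_i is applied to states of layer i)
    (∀ (i : ℕ) → i ≤ n → (v : List Bool) → length v ≡ k t i → Layer i (α i v))
  × (∀ (i : ℕ) → i < t → i < n → (v : List Bool) → length v ≡ i → (y : Bool) →
       S i (α i v) [ y ] ≡ α (suc i) (v ++ [ y ]))
  × (∀ (i : ℕ) → t ≤ i → i < n → (x y : Bool) → (v : List Bool) → length v ≡ t ∸ 1 →
       S i (α i (x ∷ v)) [ y ] ≡ α (suc i) (v ++ [ y ]))
  where open UnanimityProgram U

{-# OPTIONS --safe #-}
-- An SWBP reaches the same state on any two words of length i + t that share
-- their last t letters, so α i v can be taken to be the state reached on v
-- padded on the left with zeros to length i; reading one more letter slides the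
-- window, which is (1) and (2).  Conversely, (1) and (2) show, by induction
-- from the end of the word, that the state reached on a word of length i is
-- α i applied to its last k t i letters; two states of layer i therefore both
-- reach α (i + t) y after reading a word y of length t.
module Submission where

open import Defs
open import Data.Bool using (Bool; false)
open import Data.Empty using (⊥-elim)
open import Data.Fin using (Fin)
open import Data.List using (List; []; _∷_; _++_; [_]; _∷ʳ_; length; replicate)
open import Data.List.Properties using (length-++; ++-assoc; length-replicate)
open import Data.List.Reverse using (Reverse; []; _∶_∶ʳ_; reverseView)
open import Data.Nat using (ℕ; suc; _+_; _∸_; _≤_; _<_; _<?_; z≤n)
open import Data.Nat.Properties
open import Data.Product using (_,_)
open import Function.Bundles using (_⇔_; mk⇔)
open import Relation.Nullary using (yes; no)
open import Relation.Binary.PropositionalEquality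
  using (_≡_; refl; sym; trans; cong; cong₂; subst; module ≡-Reasoning)

k-≤ : ∀ t i → k t i ≤ i
k-≤ t i with i <? t
... | yes _  = ≤-refl
... | no i≮t = ≮⇒≥ i≮t

length-∷ʳ : ∀ {A : Set} (xs : List A) {x : A} → length (xs ∷ʳ x) ≡ suc (length xs)
length-∷ʳ []       = refl
length-∷ʳ (_ ∷ xs) = cong suc (length-∷ʳ xs)

∷ʳ-++-∷ʳ : ∀ {A : Set} (u v : List A) x y → (u ∷ʳ x) ++ v ∷ʳ y ≡ (u ++ x ∷ v) ∷ʳ y
∷ʳ-++-∷ʳ u v x y = trans (++-assoc u [ x ] (v ∷ʳ y)) (sym (++-assoc u (x ∷ v) [ y ]))

pad : ℕ → List Bool → List Bool
pad i v = replicate (i ∸ length v) false ++ v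

length-pad : ∀ {i} v → length v ≤ i → length (pad i v) ≡ i
length-pad {i} v v≤i = begin
  length (pad i v)                                      ≡⟨ length-++ (replicate (i ∸ length v) false) ⟩
  length (replicate (i ∸ length v) false) + length v    ≡⟨ cong (_+ length v) (length-replicate (i ∸ length v)) ⟩
  i ∸ length v + length v                               ≡⟨ m∸n+n≡m v≤i ⟩
  i                                                     ∎
  where open ≡-Reasoning

pad-exact : ∀ {i} v → length v ≡ i → pad i v ≡ v
pad-exact v refl = cong (λ m → replicate m false ++ v) (n∸n≡0 (length v))

module _ {n w} (U : UnanimityProgram n w) where
  open UnanimityProgram U

  run : List Bool → Fin w
  run = S 0 q₀

  S-++ : ∀ i q u v → S i q (u ++ v) ≡ S (i + length u) (S i q u) v
  S-++ i q []      v = cong (λ j → S j q v) (sym (+-identityʳ i))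
  S-++ i q (b ∷ u) v =
    trans (S-++ (suc i) q′ u v) (cong (λ j → S j (S (suc i) q′ u) v) (sym (+-suc i (length u))))
    where
    q′ : Fin w
    q′ = step i q b

  run-++ : ∀ {i} u v → length u ≡ i → run (u ++ v) ≡ S i (run u) v
  run-++ u v refl = S-++ 0 q₀ u v

  run-window : ∀ {t} → IsSWBP U t → ∀ u u′ v → length u ≡ length u′ → length v ≡ t →
               length u + t ≤ n → run (u ++ v) ≡ run (u′ ++ v)
  run-window sw u u′ v u≡u′ v≡t bound = begin
    run (u ++ v)              ≡⟨ run-++ u v refl ⟩
    S (length u) (run u) v    ≡⟨ sw (length u) bound v v≡t _ _ (u , refl , refl) (u′ , sym u≡u′ , refl) ⟩
    S (length u) (run u′) v   ≡⟨ sym (run-++ u′ v (sym u≡u′)) ⟩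
    run (u′ ++ v)             ∎
    where open ≡-Reasoning

  swbp⇒windowFunctions : ∀ t → 1 ≤ t → IsSWBP U t → HasWindowFunctions U t
  swbp⇒windowFunctions t 1≤t sw = α , α-layer , α-short , α-long
    where
    α : ℕ → List Bool → Fin w
    α i v = run (pad i v)

    α-layer : ∀ i → i ≤ n → (v : List Bool) → length v ≡ k t i → Layer i (α i v)
    α-layer i _ v v≡k = pad i v , length-pad v (subst (_≤ i) (sym v≡k) (k-≤ t i)) , refl

    α-short : ∀ i → i < t → i < n → (v : List Bool) → length v ≡ i → (y : Bool) →
              S i (α i v) [ y ] ≡ α (suc i) (v ∷ʳ y)
    α-short i _ _ v v≡i y = begin
      S i (α i v) [ y ]      ≡⟨ cong (λ u → S i (run u) [ y ]) (pad-exact v v≡i) ⟩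
      S i (run v) [ y ]      ≡⟨ sym (run-++ v [ y ] v≡i) ⟩
      run (v ∷ʳ y)           ≡⟨ cong run (sym (pad-exact (v ∷ʳ y) (trans (length-∷ʳ v) (cong suc v≡i)))) ⟩
      α (suc i) (v ∷ʳ y)     ∎
      where open ≡-Reasoning

    α-long : ∀ i → t ≤ i → i < n → (x y : Bool) → (v : List Bool) → length v ≡ t ∸ 1 →
             S i (α i (x ∷ v)) [ y ] ≡ α (suc i) (v ∷ʳ y)
    α-long i t≤i i<n x y v v≡t∸1 = begin
      S i (run (zeros ++ x ∷ v)) [ y ]         ≡⟨ sym (run-++ (zeros ++ x ∷ v) [ y ] (length-pad (x ∷ v) xv≤i)) ⟩
      run ((zeros ++ x ∷ v) ++ [ y ])          ≡⟨ cong run (sym (∷ʳ-++-∷ʳ zeros v x y)) ⟩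
      run ((zeros ∷ʳ x) ++ v ∷ʳ y)             ≡⟨ run-window sw (zeros ∷ʳ x) (false ∷ zeros) (v ∷ʳ y) (length-∷ʳ zeros) vy≡t bound ⟩
      run (replicate (suc d) false ++ v ∷ʳ y)  ≡⟨ cong (λ m → run (replicate m false ++ v ∷ʳ y)) (sym padding) ⟩
      α (suc i) (v ∷ʳ y)                       ∎
      where
      open ≡-Reasoning
      d : ℕ
      d = i ∸ suc (length v)
      zeros : List Bool
      zeros = replicate d false
      xv≡t : length (x ∷ v) ≡ t
      xv≡t = trans (cong suc v≡t∸1) (m+[n∸m]≡n 1≤t)
      vy≡t : length (v ∷ʳ y) ≡ t
      vy≡t = trans (length-∷ʳ v) xv≡t
      xv≤i : length (x ∷ v) ≤ i
      xv≤i = subst (_≤ i) (sym xv≡t) t≤i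
      padding : suc i ∸ length (v ∷ʳ y) ≡ suc d
      padding = trans (cong (suc i ∸_) (length-∷ʳ v)) (+-∸-assoc 1 xv≤i)
      bound : length (zeros ∷ʳ x) + t ≤ n
      bound = subst (_≤ n) (sym (begin
        length (zeros ∷ʳ x) + t   ≡⟨ cong₂ _+_ (trans (length-∷ʳ zeros) (cong suc (length-replicate d))) (sym xv≡t) ⟩
        suc d + length (x ∷ v)    ≡⟨ cong suc (m∸n+n≡m xv≤i) ⟩
        suc i                     ∎)) i<n

  module WindowFunctions⇒SWBP
    (t : ℕ) (1≤t : 1 ≤ t) (β : ℕ → List Bool → Fin w) (β-empty : β 0 [] ≡ q₀)
    (β-short : ∀ i → i < t → i < n → (v : List Bool) → length v ≡ i → (y : Bool) →
               S i (β i v) [ y ] ≡ β (suc i) (v ∷ʳ y))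
    (β-long : ∀ i → t ≤ i → i < n → (x y : Bool) → (v : List Bool) → length v ≡ t ∸ 1 →
              S i (β i (x ∷ v)) [ y ] ≡ β (suc i) (v ∷ʳ y))
    where
    open ≡-Reasoning

    run-short : ∀ {v} → Reverse v → length v ≤ t → length v ≤ n → run v ≡ β (length v) v
    run-short []              _   _   = sym β-empty
    run-short (v ∶ rv ∶ʳ y) vy≤t vy≤n = begin
      run (v ∷ʳ y)                           ≡⟨ run-++ v [ y ] refl ⟩
      S (length v) (run v) [ y ]             ≡⟨ cong (λ q → S (length v) q [ y ]) (run-short rv (<⇒≤ v<t) (<⇒≤ v<n)) ⟩
      S (length v) (β (length v) v) [ y ]    ≡⟨ β-short (length v) v<t v<n v refl y ⟩
      β (suc (length v)) (v ∷ʳ y)            ≡⟨ cong (λ i → β i (v ∷ʳ y)) (sym (length-∷ʳ v)) ⟩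
      β (length (v ∷ʳ y)) (v ∷ʳ y)           ∎
      where
      v<t : length v < t
      v<t = subst (_≤ t) (length-∷ʳ v) vy≤t
      v<n : length v < n
      v<n = subst (_≤ n) (length-∷ʳ v) vy≤n

    run-long : ∀ {u} → Reverse u → ∀ v → length v ≡ t → length u + t ≤ n →
               run (u ++ v) ≡ β (length u + t) v
    run-long [] v v≡t t≤n =
      trans (run-short (reverseView v) (≤-reflexive v≡t) (subst (_≤ n) (sym v≡t) t≤n))
            (cong (λ i → β i v) v≡t)
    run-long (u ∶ ru ∶ʳ x) v v≡t bound with reverseView v
    ... | [] = ⊥-elim (<⇒≢ 1≤t v≡t)
    ... | v ∶ _ ∶ʳ y = begin
      run ((u ∷ʳ x) ++ v ∷ʳ y)                          ≡⟨ cong run (∷ʳ-++-∷ʳ u v x y) ⟩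
      run ((u ++ x ∷ v) ++ [ y ])                       ≡⟨ run-++ (u ++ x ∷ v) [ y ] (trans (length-++ u) (cong (length u +_) xv≡t)) ⟩
      S (length u + t) (run (u ++ x ∷ v)) [ y ]         ≡⟨ cong (λ q → S (length u + t) q [ y ]) (run-long ru (x ∷ v) xv≡t (<⇒≤ u+t<n)) ⟩
      S (length u + t) (β (length u + t) (x ∷ v)) [ y ] ≡⟨ β-long (length u + t) (m≤n+m t (length u)) u+t<n x y v (cong (_∸ 1) xv≡t) ⟩
      β (suc (length u + t)) (v ∷ʳ y)                   ≡⟨ cong (λ m → β (m + t) (v ∷ʳ y)) (sym (length-∷ʳ u)) ⟩
      β (length (u ∷ʳ x) + t) (v ∷ʳ y)                  ∎
      where
      xv≡t : length (x ∷ v) ≡ t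
      xv≡t = trans (sym (length-∷ʳ v)) v≡t
      u+t<n : length u + t < n
      u+t<n = subst (_≤ n) (cong (_+ t) (length-∷ʳ u)) bound

    S-layer : ∀ {i q} y → Layer i q → length y ≡ t → i + t ≤ n → S i q y ≡ β (i + t) y
    S-layer y (u , refl , refl) y≡t bound =
      trans (sym (run-++ u y refl)) (run-long (reverseView u) y y≡t bound)

    isSWBP : IsSWBP U t
    isSWBP i bound y y≡t q q′ q∈Qᵢ q′∈Qᵢ =
      trans (S-layer y q∈Qᵢ y≡t bound) (sym (S-layer y q′∈Qᵢ y≡t bound))

  windowFunctions⇒swbp : ∀ t → 1 ≤ t → HasWindowFunctions U t → IsSWBP U t
  windowFunctions⇒swbp t 1≤t (β , β-layer , β-short , β-long) =
    WindowFunctions⇒SWBP.isSWBP t 1≤t β β-empty β-short β-long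
    where
    β-empty : β 0 [] ≡ q₀
    β-empty with β-layer 0 z≤n [] (sym (n≤0⇒n≡0 (k-≤ t 0)))
    ... | [] , refl , q₀≡β = sym q₀≡β

theorem1p4 : ∀ {n w : ℕ} (U : UnanimityProgram n w) (t : ℕ) → 1 ≤ t →
               IsSWBP U t ⇔ HasWindowFunctions U t
theorem1p4 U t 1≤t = mk⇔ (swbp⇒windowFunctions U t 1≤t) (windowFunctions⇒swbp U t 1≤t)
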